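{- Let $\mathcal{D}$ be a database, $\mathcal{A}=(\Sigma,Q,\Delta,I,F)$ an automaton and $s,t$ vertices of $\mathcal{D}$ such that at least one walk from $s$ to $t$ matches $\mathcal{A}$. Let $C$ be the result of \textsc{Trim} applied to the annotation produced by \textsc{Annotate} (described in the context), and let $\mathcal{T}$ and $S(\cdot)$ be as defined in the context. Let $e\cdot w$ be a node of $\mathcal{T}$, where $e$ is an edge and $w$ a walk, and let $u=\mathrm{tgt}(e)$. For every $p\in Q$, let $X_p$ be the (unique) list of states such that $(e,X_p)\in C_u[p]$ if such a list exists, and $X_p=\emptyset$ otherwise. Then $$S(e\cdot w)=\bigcup_{p\in S(w)}\mathrm{set}(X_p),$$ where $\mathrm{set}(X)$ is the set of elements of the list $X$.
   Context: A database is $\mathcal{D}=(\Sigma,V,E,\mathrm{src},\mathrm{tgt},\mathrm{lbl})$ with $\mathrm{lbl}:E\to 2^\Sigma$. For a vertex $u$, $\mathrm{In}(u)$ (resp. $\mathrm{Out}(u)$) is a fixed array of edges with target (resp. source) $u$, $\mathrm{indeg}(u)=|\mathrm{In}(u)|$, and $\mathrm{tgtidx}(e)$ is the position of $e$ in $\mathrm{In}(\mathrm{tgt}(e))$. A walk $\langle v_0,e_0,\dots,e_{k-1},v_k\rangle$ has length $k$ and label set $\{a_0\cdots a_{k-1}:a_i\in\mathrm{lbl}(e_i)\}$; walks are concatenated when the target of the first is the source of the second, and $e\cdot w$ denotes prepending edge $e$ to walk $w$; $\langle t\rangle$ is the walk of length 0 at $t$. $\Delta$ is extended to words; $\Delta(X,U)$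 and $\Delta^{ -1}(U,Y)$ denote the sets of states reachable from $X$ by a word of $U$, resp. from which $Y$ is reachable by a word of $U$. A walk matches $\mathcal{A}$ if one of its labels is in $L(\mathcal{A})$; $\lambda$ is the minimal length of a walk from $s$ to $t$ matching $\mathcal{A}$, and $[\![\mathcal{A}]\!](\mathcal{D},s,t)$ is the set of walks from $s$ to $t$ of length $\lambda$ matching $\mathcal{A}$. Tree $\mathcal{T}$: its nodes are the walks $w$ such that $w'\cdot w\in[\![\mathcal{A}]\!](\mathcal{D},s,t)$ for some walk $w'$; its root is $\langle t\rangle$; the children of $w$ are the nodes of the form $e\cdot w$, ordered by increasing $\mathrm{tgtidx}(e)$. For a node $w$, $S(w)$ is the set of states $q$ for which there exists a walk $w_q$ with $w_q\cdot w\in[\![\mathcal{A}]\!](\mathcal{D},s,t)$ and $q\in\Delta(I,\mathrm{lbl}(w_q))\cap\Delta^{ -1}(\mathrm{lbl}(w),F)$. Procedure \textsc{Annotate}: for each vertex $u$, $B_u$ maps each $(p,i)$, $p\in Q$, $0\le i<\mathrm{indeg}(u)$, to a list of states, initially empty; $L_u$ is a partial map $Q\to\mathbb{N}$, initially empty. Set $\ell=0$; for each $p\in I$ set $L_s[p]=0$ and add $(s,p)$ to list next; stop $=$ false. While next nonempty and stop false: $\ell\gets\ell+1$, current $\gets$ next, next $\gets$ empty; for each $(v,q)$ in current, each $e\in\mathrm{Out}(v)$ with $u=\mathrm{tgt}(e)$, each $p\in\bigcup_{a\in\mathrm{lbl}(e)}\Delta(q,a)$: if $L_u[p]$ undefined,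 set $L_u[p]=\ell$, add $(u,p)$ to next, set stop $=$ true if $u=t$ and $p\in F$, append $q$ to $B_u[p][\mathrm{tgtidx}(e)]$; else if $L_u[p]=\ell$, append $q$ to $B_u[p][\mathrm{tgtidx}(e)]$. Return $B,L,\ell$. Procedure \textsc{Trim}$(B)$: for each vertex $u$ and $p\in Q$, $C_u[p]$ is the queue of the pairs $(e,B_u[p][\mathrm{tgtidx}(e)])$, for $e\in\mathrm{In}(u)$ with $B_u[p][\mathrm{tgtidx}(e)]$ nonempty, in increasing $\mathrm{tgtidx}(e)$ order. -}

module Defs where

open import Data.Nat using (ℕ; zero; suc; _*_; _≤_)
import Data.Nat as ℕ
open import Data.Bool using (Bool; true; false; _∨_; _∧_; if_then_else_)
open import Data.Maybe using (Maybe; just; nothing)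
open import Data.Fin using (Fin)
open import Data.Fin.Properties using (_≟_; any?)
open import Data.Fin.Subset using (Subset) renaming (_∈_ to _∈ˢ_)
open import Data.Fin.Subset.Properties using () renaming (_∈?_ to _∈ˢ?_)
open import Data.List using (List; []; _∷_; _++_; [_]; foldl; filter; map; length)
open import Data.List.Base using (allFin)
open import Data.List.Membership.Propositional using (_∈_)
open import Data.List.Relation.Unary.Unique.Propositional using (Unique)
open import Data.List.Relation.Binary.Pointwise using (Pointwise)
open import Data.Product using (Σ; ∃; ∃-syntax; _×_; _,_; proj₁; proj₂)
open import Data.Unit using (⊤)
open import Function.Bundles using (_⇔_)
open import Relation.Binary.PropositionalEquality using (_≡_)
open import Relation.Nullary using (¬_; yes; no; does)
open import Relation.Nullary.Decidable using (_×-dec_)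

-- In u / Out u are FIXED (arbitrary) arrays: duplicate-free lists
-- enumerating exactly the edges with target / source u.

record Database (k : ℕ) : Set where
  field
    nV nE : ℕ
    src tgt : Fin nE → Fin nV
    lbl : Fin nE → Subset k
    In Out : Fin nV → List (Fin nE)
    In-unique : ∀ u → Unique (In u)
    In-spec : ∀ u e → (e ∈ In u) ⇔ (tgt e ≡ u)
    Out-unique : ∀ u → Unique (Out u)
    Out-spec : ∀ u e → (e ∈ Out u) ⇔ (src e ≡ u)

record Automaton (k : ℕ) : Set where
  field
    nQ : ℕ
    Δ : Fin nQ → Fin k → Subset nQ
    I F : Subset nQ

-- position of an element in a list (first occurrence); length if absent
indexOf : ∀ {n} → Fin n → List (Fin n) → ℕ
indexOf x [] = 0
indexOf x (y ∷ ys) with does (x ≟ y)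
... | true = 0
... | false = suc (indexOf x ys)

module Semantics {k : ℕ} (D : Database k) (A : Automaton k)
                 (s t : Fin (Database.nV D)) where
  open Database D
  open Automaton A

  V = Fin nV
  E = Fin nE
  Q = Fin nQ
  Word = List (Fin k)

  Walk : Set
  Walk = V × List E

  start : Walk → V
  start = proj₁

  edges : Walk → List E
  edges = proj₂

  end′ : V → List E → V
  end′ v [] = v
  end′ v (e ∷ es) = end′ (tgt e) es

  end : Walk → V
  end (v , es) = end′ v es

  IsWalk′ : V → List E → Set
  IsWalk′ v [] = ⊤
  IsWalk′ v (e ∷ es) = (src e ≡ v) × IsWalk′ (tgt e) es

  IsWalk : Walk → Set
  IsWalk (v , es) = IsWalk′ v es

  len : Walk → ℕ
  len w = length (edges w)

  ⟨_⟩ : V → Walk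
  ⟨ v ⟩ = v , []

  -- concatenation w₁ · w₂ (meaningful when end w₁ ≡ start w₂)
  _·_ : Walk → Walk → Walk
  w₁ · w₂ = start w₁ , edges w₁ ++ edges w₂

  -- prepending an edge e · w (meaningful when tgt e ≡ start w)
  _◂_ : E → Walk → Walk
  e ◂ w = src e , e ∷ edges w

  HasLabel : Walk → Word → Set
  HasLabel w word = Pointwise (λ a e → a ∈ˢ lbl e) word (edges w)

  data Run : Q → Word → Q → Set where
    done : ∀ {q} → Run q [] q
    step : ∀ {q q′ r a u} → q′ ∈ˢ Δ q a → Run q′ u r → Run q (a ∷ u) r

  InL : Word → Set
  InL u = ∃[ i ] ∃[ f ] (i ∈ˢ I × f ∈ˢ F × Run i u f)

  Matches : Walk → Set
  Matches w = ∃[ u ] (HasLabel w u × InL u)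

  Reach : Walk → Q → Set
  Reach w q = ∃[ i ] ∃[ u ] (i ∈ˢ I × HasLabel w u × Run i u q)

  CoReach : Walk → Q → Set
  CoReach w q = ∃[ f ] ∃[ u ] (f ∈ˢ F × HasLabel w u × Run q u f)

  MatchST : Walk → Set
  MatchST w = IsWalk w × start w ≡ s × end w ≡ t × Matches w

  InSem : Walk → Set
  InSem w = MatchST w × (∀ w′ → MatchST w′ → len w ≤ len w′)

  Node : Walk → Set
  Node w = ∃[ w′ ] (end w′ ≡ start w × InSem (w′ · w))

  S : Walk → Q → Set
  S w q = ∃[ wq ] (end wq ≡ start w × InSem (wq · w) × Reach wq q × CoReach w q)

  tgtidx : E → ℕ
  tgtidx e = indexOf e (In (tgt e))

  record State : Set where
    field
      B : V → Q → ℕ → List Q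
      L : V → Q → Maybe ℕ
      next : List (V × Q)
      stop : Bool
  open State

  appendB : (V → Q → ℕ → List Q) → V → Q → ℕ → Q → (V → Q → ℕ → List Q)
  appendB b u p i q u′ p′ i′ with does (u ≟ u′) ∧ does (p ≟ p′) ∧ does (i ℕ.≟ i′)
  ... | true = b u′ p′ i′ ++ [ q ]
  ... | false = b u′ p′ i′

  setL : (V → Q → Maybe ℕ) → V → Q → ℕ → (V → Q → Maybe ℕ)
  setL l u p m u′ p′ with does (u ≟ u′) ∧ does (p ≟ p′)
  ... | true = just m
  ... | false = l u′ p′

  update : ℕ → Q → E → Q → State → State
  update ℓ q e p st with L st (tgt e) p
  ... | nothing = record st
        { L = setL (L st) (tgt e) p ℓ
        ; next = next st ++ [ (tgt e , p) ]
        ; stop = stop st ∨ (does (tgt e ≟ t) ∧ does (p ∈ˢ? F))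
        ; B = appendB (B st) (tgt e) p (tgtidx e) q }
  ... | just m = if does (m ℕ.≟ ℓ)
                 then record st { B = appendB (B st) (tgt e) p (tgtidx e) q }
                 else st

  post : Q → E → List Q
  post q e = filter (λ p → any? (λ a → (a ∈ˢ? lbl e) ×-dec (p ∈ˢ? Δ q a))) (allFin nQ)

  processPair : ℕ → State → V × Q → State
  processPair ℓ st (v , q) =
    foldl (λ st₁ e → foldl (λ st₂ p → update ℓ q e p st₂) st₁ (post q e)) st (Out v)

  loop : ℕ → ℕ → State → State × ℕ
  loop zero ℓ st = st , ℓ
  loop (suc f) ℓ st with next st | stop st
  ... | [] | _ = st , ℓ
  ... | _ ∷ _ | true = st , ℓ
  ... | cur@(_ ∷ _) | false =
        loop f (suc ℓ) (foldl (processPair (suc ℓ)) (record st { next = [] }) cur)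

  initIs : List Q
  initIs = filter (λ p → p ∈ˢ? I) (allFin nQ)

  initState : State
  initState = record
    { B = λ _ _ _ → []
    ; L = λ u p → if does (u ≟ s) ∧ does (p ∈ˢ? I) then just 0 else nothing
    ; next = map (λ p → (s , p)) initIs
    ; stop = false }

  annotate : (V → Q → ℕ → List Q) × (V → Q → Maybe ℕ) × ℕ
  annotate with loop (suc (nV * nQ)) 0 initState
  ... | st , ℓ = B st , L st , ℓ

  nonEmpty : List Q → Bool
  nonEmpty [] = false
  nonEmpty (_ ∷ _) = true

  trim : (V → Q → ℕ → List Q) → V → Q → List (E × List Q)
  trim b u p =
    map (λ e → e , b u p (tgtidx e))
        (filter (λ e → nonEmpty (b u p (tgtidx e)) Data.Bool.≟ true) (In u))
    where import Data.Bool

  C : V → Q → List (E × List Q)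
  C = trim (proj₁ annotate)

  lookupQ : E → List (E × List Q) → List Q
  lookupQ e [] = []
  lookupQ e ((e′ , X) ∷ rest) with does (e ≟ e′)
  ... | true = X
  ... | false = lookupQ e rest

  X : E → Q → List Q
  X e p = lookupQ e (C (tgt e) p)

-- ANNOTATE is a breadth-first search of the product graph D × A from {s} × I: the pairs
-- (u, p) of level ℓ are those at distance ℓ, and q is appended to B u p i exactly when the
-- i-th incoming edge of u is the last edge of a shortest path to (u, p) leaving state q.
-- A prefix wₚ of a shortest matching walk wₚ · w is itself a shortest path to
-- (start w, p), since any shorter one could replace it. Hence, for e · w a suffix with
-- tgt e = start w, the states q ∈ S(e · w) are those one shortest-path step before some
-- p ∈ S(w), i.e. q ∈ X e p. The search does reach level λ within its |V| · |Q| + 1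
-- rounds: it never stops earlier, and λ < |V| · |Q| because the prefixes of a shortest
-- matching walk sit at distinct distances, hence at distinct pairs.

module Submission where

open import Defs
open import Data.Bool using (true; false; T; _∨_; _∧_)
open import Data.Bool.Properties using (not-¬)
import Data.Bool as Bool
open import Data.Empty using (⊥-elim)
open import Data.Fin using (Fin; toℕ; combine)
import Data.Fin.Properties as Fin
open import Data.Fin.Subset using () renaming (_∈_ to _∈ˢ_)
open import Data.Fin.Subset.Properties using () renaming (_∈?_ to _∈ˢ?_)
open import Data.List
  using (List; []; _∷_; _++_; [_]; _∷ʳ_; foldl; filter; map; concatMap; length; take; drop; allFin; initLast; _∷ʳ′_)
open import Data.List.Properties
  using (++-assoc; ++-identityʳ; length-++; length-++-sucʳ; length-++-≤ˡ; take++drop≡id; length-take)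
open import Data.List.Membership.Propositional using (_∈_; find; lose)
open import Data.List.Membership.Propositional.Properties
  using (∈-++⁺ˡ; ∈-++⁺ʳ; ∈-++⁻; ∈-map⁺; ∈-map⁻; ∈-allFin; ∈-filter⁺; ∈-filter⁻; ∈-concatMap⁺; ∈-concatMap⁻)
open import Data.List.Relation.Unary.Any using (here; there)
open import Data.List.Relation.Binary.Pointwise using ([]; _∷_)
open import Data.Maybe using (just; nothing)
open import Data.Nat using (ℕ; zero; suc; _+_; _*_; _≤_; _<_; z≤n; s≤s; _≤?_; _<?_; _≡ᵇ_)
open import Data.Nat.Properties
open import Data.Product using (∃₂; ∃-syntax; _×_; _,_; proj₁; proj₂; map₁; map₂)
open import Data.Sum using (_⊎_; inj₁; inj₂; fromInj₁)
open import Data.Unit using (tt)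
open import Function.Bundles using (_⇔_; mk⇔; Equivalence)
open import Relation.Binary.PropositionalEquality
  using (_≡_; _≢_; refl; sym; trans; cong; subst; subst₂; module ≡-Reasoning)
open import Relation.Nullary using (¬_; yes; no; does)
open import Relation.Nullary.Decidable using (_×-dec_)

open Equivalence using (to; from)

foldl-concatMap-invariant : ∀ {a b c p} {X : Set a} {Y : Set b} {Z : Set c}
  (P : List Z → Y → Set p) (g : X → List Z) (f : Y → X → Y) →
  (∀ zs y x → P zs y → P (zs ++ g x) (f y x)) →
  ∀ xs zs y → P zs y → P (zs ++ concatMap g xs) (foldl f y xs)
foldl-concatMap-invariant P g f step [] zs y pz =
  subst (λ zs′ → P zs′ y) (sym (++-identityʳ zs)) pz
foldl-concatMap-invariant P g f step (x ∷ xs) zs y pz =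
  subst (λ zs′ → P zs′ _) (++-assoc zs (g x) (concatMap g xs))
        (foldl-concatMap-invariant P g f step xs (zs ++ g x) (f y x) (step zs y x pz))

length-∷ʳ : ∀ {a} {X : Set a} (xs : List X) x → length (xs ∷ʳ x) ≡ suc (length xs)
length-∷ʳ xs x = trans (length-++ xs) (+-comm (length xs) 1)

indexOf-injective : ∀ {n} {x y : Fin n} xs → x ∈ xs → y ∈ xs → indexOf x xs ≡ indexOf y xs → x ≡ y
indexOf-injective {x = x} {y} (z ∷ zs) x∈ y∈ eq with x Fin.≟ z | y Fin.≟ z
... | yes x≡z | yes y≡z = trans x≡z (sym y≡z)
... | no x≢z  | no y≢z  = indexOf-injective zs (tail x≢z x∈) (tail y≢z y∈) (suc-injective eq)
  where
  tail : ∀ {a} → a ≢ z → a ∈ z ∷ zs → a ∈ zs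
  tail a≢z (here a≡z) = ⊥-elim (a≢z a≡z)
  tail a≢z (there a∈) = a∈
indexOf-injective (z ∷ zs) _ _ () | yes _ | no _
indexOf-injective (z ∷ zs) _ _ () | no _  | yes _

-- In update and appendB, does (m ℕ.≟ n) computes to m ≡ᵇ n; these read the test back.
≡ᵇ-true⇒≡ : ∀ m n → (m ≡ᵇ n) ≡ true → m ≡ n
≡ᵇ-true⇒≡ m n eq = ≡ᵇ⇒≡ m n (subst T (sym eq) tt)

≡ᵇ-false⇒≢ : ∀ m n → (m ≡ᵇ n) ≡ false → m ≢ n
≡ᵇ-false⇒≢ m _ eq refl with subst T eq (≡⇒≡ᵇ m m refl)
... | ()

module _ {k : ℕ} (D : Database k) (A : Automaton k) (s t : Fin (Database.nV D)) where
  open Database D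
  open Automaton A
  open Semantics D A s t
  open State

  Step : Q → E → Q → Set
  Step q e p = ∃[ a ] (a ∈ˢ lbl e × p ∈ˢ Δ q a)

  data Path : Q → V → List E → Q → Set where
    nil  : ∀ {q v} → Path q v [] q
    cons : ∀ {q v e es p r} → src e ≡ v → Step q e p → Path p (tgt e) es r → Path q v (e ∷ es) r

  walk-run⇒Path : ∀ {v es u q r} → IsWalk′ v es → HasLabel (v , es) u → Run q u r → Path q v es r
  walk-run⇒Path {es = []} _ [] done = nil
  walk-run⇒Path {es = e ∷ es} (src≡ , walk) (a∈ ∷ labels) (step p∈ run) =
    cons src≡ (_ , a∈ , p∈) (walk-run⇒Path walk labels run)

  Path⇒walk-run : ∀ {v es q r} → Path q v es r → IsWalk′ v es × ∃[ u ] (HasLabel (v , es) u × Run q u r)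
  Path⇒walk-run nil = tt , [] , [] , done
  Path⇒walk-run (cons src≡ (a , a∈ , p∈) path) with Path⇒walk-run path
  ... | walk , u , labels , run = (src≡ , walk) , a ∷ u , a∈ ∷ labels , step p∈ run

  end′-++ : ∀ v es₁ es₂ → end′ v (es₁ ++ es₂) ≡ end′ (end′ v es₁) es₂
  end′-++ v [] es₂ = refl
  end′-++ v (e ∷ es₁) es₂ = end′-++ (tgt e) es₁ es₂

  IsWalk′-++⁻ : ∀ v es₁ es₂ → IsWalk′ v (es₁ ++ es₂) → IsWalk′ v es₁ × IsWalk′ (end′ v es₁) es₂
  IsWalk′-++⁻ v [] es₂ walk = tt , walk
  IsWalk′-++⁻ v (e ∷ es₁) es₂ (src≡ , walk) with IsWalk′-++⁻ (tgt e) es₁ es₂ walk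
  ... | walk₁ , walk₂ = (src≡ , walk₁) , walk₂

  Path-++⁻ : ∀ {q v r} es₁ {es₂} → Path q v (es₁ ++ es₂) r → ∃[ p ] (Path q v es₁ p × Path p (end′ v es₁) es₂ r)
  Path-++⁻ [] path = _ , nil , path
  Path-++⁻ (e ∷ es₁) (cons src≡ move path) with Path-++⁻ es₁ path
  ... | p , path₁ , path₂ = p , cons src≡ move path₁ , path₂

  Path-++⁺ : ∀ {q v es₁ es₂ p r} → Path q v es₁ p → Path p (end′ v es₁) es₂ r → Path q v (es₁ ++ es₂) r
  Path-++⁺ nil path₂ = path₂
  Path-++⁺ (cons src≡ move path₁) path₂ = cons src≡ move (Path-++⁺ path₁ path₂)

  ReachableIn : ℕ → V → Q → Set
  ReachableIn m v q = ∃[ es ] (length es ≡ m × end′ s es ≡ v × ∃[ i ] (i ∈ˢ I × Path i s es q))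

  Dist : ℕ → V → Q → Set
  Dist m v q = ReachableIn m v q × (∀ m′ → ReachableIn m′ v q → m ≤ m′)

  Dist-unique : ∀ {m m′ v q} → Dist m v q → Dist m′ v q → m ≡ m′
  Dist-unique (r , min) (r′ , min′) = ≤-antisym (min _ r′) (min′ _ r)

  Dist-zero : ∀ {q} → q ∈ˢ I → Dist 0 s q
  Dist-zero q∈I = ([] , refl , refl , _ , q∈I , nil) , λ _ _ → z≤n

  ReachableIn-zero⁻ : ∀ {v q} → ReachableIn 0 v q → v ≡ s × q ∈ˢ I
  ReachableIn-zero⁻ ([] , refl , refl , i , i∈I , nil) = refl , i∈I

  ReachableIn-suc⁺ : ∀ {m e q p} → ReachableIn m (src e) q → Step q e p → ReachableIn (suc m) (tgt e) p
  ReachableIn-suc⁺ {e = e} (es , refl , end≡ , i , i∈I , path) move =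
    es ∷ʳ e , length-∷ʳ es e ,
    end′-++ s es [ e ] , i , i∈I , Path-++⁺ path (cons (sym end≡) move nil)

  ReachableIn-suc⁻ : ∀ {m u p} → ReachableIn (suc m) u p →
                     ∃₂ λ e q → tgt e ≡ u × ReachableIn m (src e) q × Step q e p
  ReachableIn-suc⁻ (es , len≡ , end≡ , i , i∈I , path) with initLast es
  ReachableIn-suc⁻ (_ , () , _) | []
  ... | es′ ∷ʳ′ e with Path-++⁻ es′ path
  ... | q , path′ , cons src≡ move nil =
    e , q , trans (sym (end′-++ s es′ [ e ])) end≡ ,
    (es′ , suc-injective (trans (sym (length-∷ʳ es′ e)) len≡) , sym src≡ , i , i∈I , path′) ,
    move

  Accepting : List E → Set
  Accepting es = end′ s es ≡ t × ∃₂ λ i f → i ∈ˢ I × f ∈ˢ F × Path i s es f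

  MatchST⇒Accepting : ∀ {v₀ es} → MatchST (v₀ , es) → v₀ ≡ s × Accepting es
  MatchST⇒Accepting (walk , refl , end≡ , u , labels , i , f , i∈I , f∈F , run) =
    refl , end≡ , i , f , i∈I , f∈F , walk-run⇒Path walk labels run

  Accepting⇒MatchST : ∀ es → Accepting es → MatchST (s , es)
  Accepting⇒MatchST es (end≡ , i , f , i∈I , f∈F , path) with Path⇒walk-run path
  ... | walk , u , labels , run = walk , refl , end≡ , u , labels , i , f , i∈I , f∈F , run

  -- Any shorter path to (v, p) could replace es₁ and give a shorter accepting walk.
  shortest-prefix-Dist : ∀ es₁ es₂ {v i p f} → InSem (s , es₁ ++ es₂) → end′ s es₁ ≡ v →
    i ∈ˢ I → Path i s es₁ p → f ∈ˢ F → Path p v es₂ f → Dist (length es₁) v p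
  shortest-prefix-Dist es₁ es₂ {v} {i} {p} {f} shortest end₁≡ i∈I path₁ f∈F path₂ =
    (es₁ , refl , end₁≡ , i , i∈I , path₁) , minimal
    where
    end≡t : end′ s (es₁ ++ es₂) ≡ t
    end≡t = proj₁ (proj₂ (MatchST⇒Accepting (proj₁ shortest)))
    minimal : ∀ m → ReachableIn m v p → length es₁ ≤ m
    minimal m (es , refl , end≡ , i′ , i′∈I , path) = +-cancelʳ-≤ (length es₂) (length es₁) m longer
      where
      open ≡-Reasoning
      end′≡t : end′ s (es ++ es₂) ≡ t
      end′≡t = begin
        end′ s (es ++ es₂)         ≡⟨ end′-++ s es es₂ ⟩
        end′ (end′ s es) es₂       ≡⟨ cong (λ x → end′ x es₂) (trans end≡ (sym end₁≡)) ⟩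
        end′ (end′ s es₁) es₂      ≡⟨ end′-++ s es₁ es₂ ⟨
        end′ s (es₁ ++ es₂)        ≡⟨ end≡t ⟩
        t                          ∎
      accepting : Accepting (es ++ es₂)
      accepting = end′≡t , i′ , f , i′∈I , f∈F , Path-++⁺ path (subst (λ x → Path p x es₂ f) (sym end≡) path₂)
      longer : length es₁ + length es₂ ≤ length es + length es₂
      longer = subst₂ _≤_ (length-++ es₁) (length-++ es)
                      (proj₂ shortest (s , es ++ es₂) (Accepting⇒MatchST _ accepting))

  shortest-Dist-at : ∀ es → InSem (s , es) → ∀ j → j ≤ length es → ∃₂ λ v q → Dist j v q
  shortest-Dist-at es shortest j j≤ with MatchST⇒Accepting (proj₁ shortest)
  ... | _ , _ , i , f , i∈I , f∈F , path
    with Path-++⁻ (take j es) (subst (λ l → Path i s l f) (sym (take++drop≡id j es)) path)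
  ... | q , path₁ , path₂ =
    end′ s (take j es) , q ,
    subst (λ m → Dist m (end′ s (take j es)) q) (trans (length-take j es) (m≤n⇒m⊓n≡m j≤))
          (shortest-prefix-Dist (take j es) (drop j es)
             (subst (λ l → InSem (s , l)) (sym (take++drop≡id j es)) shortest) refl i∈I path₁ f∈F path₂)

  shortest-length< : ∀ es → InSem (s , es) → length es < nV * nQ
  shortest-length< es shortest with suc (length es) ≤? nV * nQ
  ... | yes fits = fits
  ... | no overflow = ⊥-elim (collision (Fin.pigeonhole (≰⇒> overflow) position))
    where
    at : (j : Fin (suc (length es))) → ∃₂ λ v q → Dist (toℕ j) v q
    at j = shortest-Dist-at es shortest (toℕ j) (≤-pred (Fin.toℕ<n j))
    position : Fin (suc (length es)) → Fin (nV * nQ)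
    position j = combine (proj₁ (at j)) (proj₁ (proj₂ (at j)))
    collision : ¬ ∃₂ (λ i j → toℕ i < toℕ j × position i ≡ position j)
    collision (i , j , i<j , same) with Fin.combine-injective _ _ _ _ same
    ... | v≡ , q≡ = <⇒≢ i<j (Dist-unique (proj₂ (proj₂ (at i)))
                                         (subst₂ (Dist (toℕ j)) (sym v≡) (sym q≡) (proj₂ (proj₂ (at j)))))

  appendB-∈ : ∀ b u p i q u′ p′ i′ q′ → q′ ∈ appendB b u p i q u′ p′ i′ ⇔
              (q′ ∈ b u′ p′ i′ ⊎ (u ≡ u′ × p ≡ p′ × i ≡ i′ × q′ ≡ q))
  appendB-∈ b u p i q u′ p′ i′ q′ with u Fin.≟ u′ | p Fin.≟ p′ | i ≡ᵇ i′ in i≡ᵇi′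
  ... | no u≢u′ | _ | _ = mk⇔ inj₁ (fromInj₁ λ (u≡u′ , _) → ⊥-elim (u≢u′ u≡u′))
  ... | yes _ | no p≢p′ | _ = mk⇔ inj₁ (fromInj₁ λ (_ , p≡p′ , _) → ⊥-elim (p≢p′ p≡p′))
  ... | yes _ | yes _ | false = mk⇔ inj₁ (fromInj₁ λ (_ , _ , i≡i′ , _) → ⊥-elim (≡ᵇ-false⇒≢ i i′ i≡ᵇi′ i≡i′))
  ... | yes refl | yes refl | true with ≡ᵇ-true⇒≡ i i′ i≡ᵇi′
  ... | refl = mk⇔ split join
    where
    split : q′ ∈ b u p i ++ [ q ] → q′ ∈ b u p i ⊎ (u ≡ u × p ≡ p × i ≡ i × q′ ≡ q)
    split q′∈ with ∈-++⁻ (b u p i) q′∈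
    ... | inj₁ old = inj₁ old
    ... | inj₂ (here q′≡q) = inj₂ (refl , refl , refl , q′≡q)
    join : q′ ∈ b u p i ⊎ (u ≡ u × p ≡ p × i ≡ i × q′ ≡ q) → q′ ∈ b u p i ++ [ q ]
    join (inj₁ old) = ∈-++⁺ˡ old
    join (inj₂ (_ , _ , _ , q′≡q)) = ∈-++⁺ʳ (b u p i) (here q′≡q)

  setL-cases : ∀ l u p m u′ p′ → (u ≡ u′ × p ≡ p′ × setL l u p m u′ p′ ≡ just m)
                                ⊎ (¬ (u ≡ u′ × p ≡ p′) × setL l u p m u′ p′ ≡ l u′ p′)
  setL-cases l u p m u′ p′ with u Fin.≟ u′ | p Fin.≟ p′
  ... | yes u≡u′ | yes p≡p′ = inj₁ (u≡u′ , p≡p′ , refl)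
  ... | no u≢u′ | _ = inj₂ ((λ (u≡u′ , _) → u≢u′ u≡u′) , refl)
  ... | yes _ | no p≢p′ = inj₂ ((λ (_ , p≡p′) → p≢p′ p≡p′) , refl)

  post-∈ : ∀ q e p → p ∈ post q e ⇔ Step q e p
  post-∈ q e p = mk⇔ (λ p∈ → proj₂ (∈-filter⁻ step? {xs = allFin nQ} p∈))
                     (∈-filter⁺ step? (∈-allFin p))
    where
    step? = λ p → Fin.any? (λ a → (a ∈ˢ? lbl e) ×-dec (p ∈ˢ? Δ q a))

  ∨-true⁻ : ∀ x y → x ∨ y ≡ true → x ≡ true ⊎ y ≡ true
  ∨-true⁻ true _ _ = inj₁ refl
  ∨-true⁻ false _ y≡true = inj₂ y≡true

  final-test⁻ : ∀ u p → (does (u Fin.≟ t) ∧ does (p ∈ˢ? F)) ≡ true → u ≡ t × p ∈ˢ F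
  final-test⁻ u p test with u Fin.≟ t | p ∈ˢ? F
  final-test⁻ u p () | no _ | _
  final-test⁻ u p () | yes _ | no _
  ... | yes u≡t | yes p∈F = u≡t , p∈F

  ShortestStep : ℕ → Q → E → Q → Set
  ShortestStep m q e p = Step q e p × Dist m (src e) q × Dist (suc m) (tgt e) p

  BEntry : ℕ → V → Q → ℕ → Q → Set
  BEntry ℓ u p i q = ∃₂ λ e m → tgt e ≡ u × tgtidx e ≡ i × suc m ≤ ℓ × ShortestStep m q e p

  record Invariant (ℓ : ℕ) (st : State) : Set where
    field
      L-just    : ∀ v q m → L st v q ≡ just m → m ≤ ℓ × Dist m v q
      L-nothing : ∀ v q → L st v q ≡ nothing → ∀ m → m ≤ ℓ → ¬ ReachableIn m v q
      next-∈    : ∀ v q → (v , q) ∈ next st ⇔ L st v q ≡ just ℓ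
      B-∈       : ∀ u p i q → q ∈ B st u p i ⇔ BEntry ℓ u p i q
      stop-true : stop st ≡ true → ∃[ f ] (f ∈ˢ F × ReachableIn ℓ t f)

  Invariant-Dist⇒L : ∀ {ℓ st m v q} → Invariant ℓ st → Dist m v q → m ≤ ℓ → L st v q ≡ just m
  Invariant-Dist⇒L {st = st} {m} {v} {q} inv dist m≤ℓ with L st v q in L≡
  ... | nothing = ⊥-elim (Invariant.L-nothing inv v q L≡ m m≤ℓ (proj₁ dist))
  ... | just m′ = cong just (Dist-unique (proj₂ (Invariant.L-just inv v q m′ L≡)) dist)

  initL-cases : ∀ v q → (v ≡ s × q ∈ˢ I × L initState v q ≡ just 0)
                        ⊎ (¬ (v ≡ s × q ∈ˢ I) × L initState v q ≡ nothing)
  initL-cases v q with v Fin.≟ s | q ∈ˢ? I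
  ... | yes v≡s | yes q∈I = inj₁ (v≡s , q∈I , refl)
  ... | yes _ | no q∉I = inj₂ ((λ (_ , q∈I) → q∉I q∈I) , refl)
  ... | no v≢s | _ = inj₂ ((λ (v≡s , _) → v≢s v≡s) , refl)

  initState-Invariant : Invariant 0 initState
  initState-Invariant = record
    { L-just = L-just ; L-nothing = L-nothing ; next-∈ = next-∈
    ; B-∈ = λ _ _ _ _ → mk⇔ (λ ()) (λ { (_ , _ , _ , _ , () , _) })
    ; stop-true = λ () }
    where
    L-just : ∀ v q m → L initState v q ≡ just m → m ≤ 0 × Dist m v q
    L-just v q m L≡ with initL-cases v q
    ... | inj₁ (refl , q∈I , L≡0) with trans (sym L≡0) L≡
    ... | refl = z≤n , Dist-zero q∈I
    L-just v q m L≡ | inj₂ (_ , L≡nothing) with trans (sym L≡) L≡nothing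
    ... | ()
    L-nothing : ∀ v q → L initState v q ≡ nothing → ∀ m → m ≤ 0 → ¬ ReachableIn m v q
    L-nothing v q L≡ .0 z≤n r with initL-cases v q
    ... | inj₁ (_ , _ , L≡0) with trans (sym L≡0) L≡
    ... | ()
    L-nothing v q L≡ .0 z≤n r | inj₂ (not-initial , _) = not-initial (ReachableIn-zero⁻ r)
    next-∈ : ∀ v q → (v , q) ∈ next initState ⇔ L initState v q ≡ just 0
    next-∈ v q = mk⇔ listed⇒L L⇒listed
      where
      listed⇒L : (v , q) ∈ next initState → L initState v q ≡ just 0
      listed⇒L vq∈ with ∈-map⁻ (λ p → (s , p)) vq∈
      ... | p , p∈ , refl with initL-cases s p
      ... | inj₁ (_ , _ , L≡0) = L≡0
      ... | inj₂ (not-initial , _) =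
        ⊥-elim (not-initial (refl , proj₂ (∈-filter⁻ (λ p → p ∈ˢ? I) {xs = allFin nQ} p∈)))
      L⇒listed : L initState v q ≡ just 0 → (v , q) ∈ next initState
      L⇒listed L≡ with initL-cases v q
      ... | inj₁ (refl , q∈I , _) = ∈-map⁺ (λ p → (s , p)) (∈-filter⁺ (λ p → p ∈ˢ? I) (∈-allFin q) q∈I)
      ... | inj₂ (_ , L≡nothing) with trans (sym L≡) L≡nothing
      ... | ()

  Triple : Set
  Triple = Q × E × Q

  module Layer {ℓ : ℕ} {st : State} (inv : Invariant ℓ st) where
    open Invariant inv

    Hit : List Triple → V → Q → Set
    Hit T u p = ∃₂ λ q e → tgt e ≡ u × (q , e , p) ∈ T

    Hit-++ˡ : ∀ {T} T′ {u p} → Hit T u p → Hit (T ++ T′) u p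
    Hit-++ˡ T′ (q , e , tgt≡ , qep∈) = q , e , tgt≡ , ∈-++⁺ˡ qep∈

    Hit-∷ʳ : ∀ T {q e p} → Hit (T ∷ʳ (q , e , p)) (tgt e) p
    Hit-∷ʳ T {q} {e} = q , e , refl , ∈-++⁺ʳ T (here refl)

    Hit-∷ʳ⁻ : ∀ T {q e p u p′} → Hit (T ∷ʳ (q , e , p)) u p′ → Hit T u p′ ⊎ (tgt e ≡ u × p ≡ p′)
    Hit-∷ʳ⁻ T (q′ , e′ , tgt≡ , qep∈) with ∈-++⁻ T qep∈
    ... | inj₁ old = inj₁ (q′ , e′ , tgt≡ , old)
    ... | inj₂ (here refl) = inj₂ (tgt≡ , refl)

    PartialBEntry : List Triple → V → Q → ℕ → Q → Set
    PartialBEntry T u p i q =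
      q ∈ B st u p i ⊎ (L st u p ≡ nothing × ∃[ e ] (tgt e ≡ u × tgtidx e ≡ i × (q , e , p) ∈ T))

    -- Partial T st′: the round of the while loop started in st has processed the
    -- triples (q, e, p) of T, in this order, and reached st′.
    record Partial (T : List Triple) (st′ : State) : Set where
      field
        L-kept     : ∀ u p m → L st u p ≡ just m → L st′ u p ≡ just m
        L-new      : ∀ u p → L st u p ≡ nothing →
                     (L st′ u p ≡ nothing × ¬ Hit T u p) ⊎ (L st′ u p ≡ just (suc ℓ) × Hit T u p)
        B-∈′       : ∀ u p i q → q ∈ B st′ u p i ⇔ PartialBEntry T u p i q
        next-∈′    : ∀ u p → (u , p) ∈ next st′ ⇔ (L st u p ≡ nothing × Hit T u p)
        stop-true′ : stop st′ ≡ true → ∃[ f ] (f ∈ˢ F × Hit T t f)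

    Partial-[] : stop st ≡ false → Partial [] (record st { next = [] })
    Partial-[] stop≡false = record
      { L-kept = λ _ _ _ L≡ → L≡
      ; L-new = λ _ _ L≡ → inj₁ (L≡ , λ { (_ , _ , _ , ()) })
      ; B-∈′ = λ _ _ _ _ → mk⇔ inj₁ (fromInj₁ λ { (_ , _ , _ , _ , ()) })
      ; next-∈′ = λ _ _ → mk⇔ (λ ()) (λ { (_ , _ , _ , _ , ()) })
      ; stop-true′ = λ stop≡true → ⊥-elim (not-¬ stop≡false stop≡true) }

    module Extend {T : List Triple} {st′ : State} (part : Partial T st′) (q : Q) (e : E) (p : Q) where
      open Partial part

      T′ : List Triple
      T′ = T ∷ʳ (q , e , p)

      B-appended : L st (tgt e) p ≡ nothing → ∀ u′ p′ i′ q′ →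
                   q′ ∈ appendB (B st′) (tgt e) p (tgtidx e) q u′ p′ i′ ⇔ PartialBEntry T′ u′ p′ i′ q′
      B-appended fresh u′ p′ i′ q′ = mk⇔ split join
        where
        appended = appendB-∈ (B st′) (tgt e) p (tgtidx e) q u′ p′ i′ q′
        split : q′ ∈ appendB (B st′) (tgt e) p (tgtidx e) q u′ p′ i′ → PartialBEntry T′ u′ p′ i′ q′
        split q′∈ with to appended q′∈
        ... | inj₂ (refl , refl , refl , refl) = inj₂ (fresh , e , refl , refl , ∈-++⁺ʳ T (here refl))
        ... | inj₁ old with to (B-∈′ u′ p′ i′ q′) old
        ... | inj₁ older = inj₁ older
        ... | inj₂ (L≡ , e′ , hit) = inj₂ (L≡ , e′ , map₂ (map₂ ∈-++⁺ˡ) hit)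
        join : PartialBEntry T′ u′ p′ i′ q′ → q′ ∈ appendB (B st′) (tgt e) p (tgtidx e) q u′ p′ i′
        join (inj₁ older) = from appended (inj₁ (from (B-∈′ u′ p′ i′ q′) (inj₁ older)))
        join (inj₂ (L≡ , e′ , tgt≡ , idx≡ , qep∈)) with ∈-++⁻ T qep∈
        ... | inj₁ old = from appended (inj₁ (from (B-∈′ u′ p′ i′ q′) (inj₂ (L≡ , e′ , tgt≡ , idx≡ , old))))
        ... | inj₂ (here refl) = from appended (inj₂ (tgt≡ , refl , idx≡ , refl))

      B-unchanged : L st (tgt e) p ≢ nothing → ∀ u′ p′ i′ q′ → q′ ∈ B st′ u′ p′ i′ ⇔ PartialBEntry T′ u′ p′ i′ q′
      B-unchanged settled u′ p′ i′ q′ = mk⇔ split join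
        where
        split : q′ ∈ B st′ u′ p′ i′ → PartialBEntry T′ u′ p′ i′ q′
        split q′∈ with to (B-∈′ u′ p′ i′ q′) q′∈
        ... | inj₁ older = inj₁ older
        ... | inj₂ (L≡ , e′ , tgt≡ , idx≡ , old) = inj₂ (L≡ , e′ , tgt≡ , idx≡ , ∈-++⁺ˡ old)
        join : PartialBEntry T′ u′ p′ i′ q′ → q′ ∈ B st′ u′ p′ i′
        join (inj₁ older) = from (B-∈′ u′ p′ i′ q′) (inj₁ older)
        join (inj₂ (L≡ , e′ , tgt≡ , idx≡ , qep∈)) with ∈-++⁻ T qep∈
        ... | inj₁ old = from (B-∈′ u′ p′ i′ q′) (inj₂ (L≡ , e′ , tgt≡ , idx≡ , old))
        ... | inj₂ (here refl) = ⊥-elim (settled (subst (λ u → L st u p ≡ nothing) (sym tgt≡) L≡))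

      Partial-same-L : ∀ b → (L st (tgt e) p ≡ nothing → Hit T (tgt e) p) →
                       (∀ u p i q → q ∈ b u p i ⇔ PartialBEntry T′ u p i q) → Partial T′ (record st′ { B = b })
      Partial-same-L b already-hit b-∈ = record
        { L-kept = L-kept ; L-new = L-new″ ; B-∈′ = b-∈ ; next-∈′ = next-∈″
        ; stop-true′ = λ stop≡true → map₂ (map₂ (Hit-++ˡ _)) (stop-true′ stop≡true) }
        where
        no-new-hit : ∀ {u′ p′} → L st u′ p′ ≡ nothing → ¬ Hit T u′ p′ → ¬ Hit T′ u′ p′
        no-new-hit fresh not-hit hit with Hit-∷ʳ⁻ T hit
        ... | inj₁ old = not-hit old
        ... | inj₂ (refl , refl) = not-hit (already-hit fresh)
        L-new″ : ∀ u′ p′ → L st u′ p′ ≡ nothing →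
                 (L st′ u′ p′ ≡ nothing × ¬ Hit T′ u′ p′) ⊎ (L st′ u′ p′ ≡ just (suc ℓ) × Hit T′ u′ p′)
        L-new″ u′ p′ fresh with L-new u′ p′ fresh
        ... | inj₁ (L≡ , not-hit) = inj₁ (L≡ , no-new-hit fresh not-hit)
        ... | inj₂ (L≡ , hit) = inj₂ (L≡ , Hit-++ˡ _ hit)
        next-∈″ : ∀ u′ p′ → (u′ , p′) ∈ next st′ ⇔ (L st u′ p′ ≡ nothing × Hit T′ u′ p′)
        next-∈″ u′ p′ = mk⇔ (λ listed → map₂ (Hit-++ˡ _) (to (next-∈′ u′ p′) listed)) listed
          where
          listed : L st u′ p′ ≡ nothing × Hit T′ u′ p′ → (u′ , p′) ∈ next st′
          listed (fresh , hit) with Hit-∷ʳ⁻ T hit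
          ... | inj₁ old = from (next-∈′ u′ p′) (fresh , old)
          ... | inj₂ (refl , refl) = from (next-∈′ u′ p′) (fresh , already-hit fresh)

      fresh-before : L st′ (tgt e) p ≡ nothing → L st (tgt e) p ≡ nothing
      fresh-before L′≡ with L st (tgt e) p in L≡
      ... | nothing = refl
      ... | just m with trans (sym (L-kept _ _ m L≡)) L′≡
      ...   | ()

      setL-kept : L st (tgt e) p ≡ nothing →
                  ∀ u′ p′ m → L st u′ p′ ≡ just m → setL (L st′) (tgt e) p (suc ℓ) u′ p′ ≡ just m
      setL-kept fresh u′ p′ m L≡ with setL-cases (L st′) (tgt e) p (suc ℓ) u′ p′
      ... | inj₂ (_ , L″≡) = trans L″≡ (L-kept u′ p′ m L≡)
      ... | inj₁ (refl , refl , _) with trans (sym L≡) fresh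
      ...   | ()

      setL-new : ∀ u′ p′ → L st u′ p′ ≡ nothing →
                 (setL (L st′) (tgt e) p (suc ℓ) u′ p′ ≡ nothing × ¬ Hit T′ u′ p′)
                 ⊎ (setL (L st′) (tgt e) p (suc ℓ) u′ p′ ≡ just (suc ℓ) × Hit T′ u′ p′)
      setL-new u′ p′ fresh′ with setL-cases (L st′) (tgt e) p (suc ℓ) u′ p′
      ... | inj₁ (refl , refl , L″≡) = inj₂ (L″≡ , Hit-∷ʳ T)
      ... | inj₂ (other , L″≡) with L-new u′ p′ fresh′
      ...   | inj₂ (L≡ , hit) = inj₂ (trans L″≡ L≡ , Hit-++ˡ _ hit)
      ...   | inj₁ (L≡ , not-hit) = inj₁ (trans L″≡ L≡ , no-hit)
        where
        no-hit : ¬ Hit T′ u′ p′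
        no-hit hit with Hit-∷ʳ⁻ T hit
        ... | inj₁ old = not-hit old
        ... | inj₂ same = other same

      next-∷ʳ-∈ : L st (tgt e) p ≡ nothing →
                  ∀ u′ p′ → (u′ , p′) ∈ next st′ ∷ʳ (tgt e , p) ⇔ (L st u′ p′ ≡ nothing × Hit T′ u′ p′)
      next-∷ʳ-∈ fresh u′ p′ = mk⇔ split join
        where
        split : (u′ , p′) ∈ next st′ ∷ʳ (tgt e , p) → L st u′ p′ ≡ nothing × Hit T′ u′ p′
        split listed with ∈-++⁻ (next st′) listed
        ... | inj₁ old = map₂ (Hit-++ˡ _) (to (next-∈′ u′ p′) old)
        ... | inj₂ (here refl) = fresh , Hit-∷ʳ T
        join : L st u′ p′ ≡ nothing × Hit T′ u′ p′ → (u′ , p′) ∈ next st′ ∷ʳ (tgt e , p)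
        join (fresh′ , hit) with Hit-∷ʳ⁻ T hit
        ... | inj₁ old = ∈-++⁺ˡ (from (next-∈′ u′ p′) (fresh′ , old))
        ... | inj₂ (refl , refl) = ∈-++⁺ʳ (next st′) (here refl)

      stop-∨-true : stop st′ ∨ (does (tgt e Fin.≟ t) ∧ does (p ∈ˢ? F)) ≡ true → ∃[ f ] (f ∈ˢ F × Hit T′ t f)
      stop-∨-true stop≡true with ∨-true⁻ (stop st′) _ stop≡true
      ... | inj₁ old = map₂ (map₂ (Hit-++ˡ _)) (stop-true′ old)
      ... | inj₂ final with final-test⁻ (tgt e) p final
      ...   | refl , p∈F = p , p∈F , Hit-∷ʳ T

      Partial-fresh : L st′ (tgt e) p ≡ nothing → Partial T′ (record st′
        { L = setL (L st′) (tgt e) p (suc ℓ)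
        ; next = next st′ ∷ʳ (tgt e , p)
        ; stop = stop st′ ∨ (does (tgt e Fin.≟ t) ∧ does (p ∈ˢ? F))
        ; B = appendB (B st′) (tgt e) p (tgtidx e) q })
      Partial-fresh L′≡ = record
        { L-kept = setL-kept fresh ; L-new = setL-new ; B-∈′ = B-appended fresh
        ; next-∈′ = next-∷ʳ-∈ fresh ; stop-true′ = stop-∨-true }
        where
        fresh : L st (tgt e) p ≡ nothing
        fresh = fresh-before L′≡

      Partial-revisit : L st′ (tgt e) p ≡ just (suc ℓ) →
                        Partial T′ (record st′ { B = appendB (B st′) (tgt e) p (tgtidx e) q })
      Partial-revisit L′≡ = Partial-same-L _ (λ _ → hit) (B-appended fresh)
        where
        fresh : L st (tgt e) p ≡ nothing
        fresh with L st (tgt e) p in L≡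
        ... | nothing = refl
        ... | just m with trans (sym (L-kept _ _ m L≡)) L′≡
        ...   | refl = ⊥-elim (<-irrefl refl (proj₁ (L-just _ _ m L≡)))
        hit : Hit T (tgt e) p
        hit with L-new (tgt e) p fresh
        ... | inj₂ (_ , hit) = hit
        ... | inj₁ (L≡ , _) with trans (sym L′≡) L≡
        ...   | ()

      Partial-stale : ∀ {m} → L st′ (tgt e) p ≡ just m → m ≢ suc ℓ → Partial T′ st′
      Partial-stale L′≡ m≢ = Partial-same-L (B st′) (λ fresh → ⊥-elim (settled fresh)) (B-unchanged settled)
        where
        settled : L st (tgt e) p ≢ nothing
        settled fresh with L-new (tgt e) p fresh
        ... | inj₁ (L≡ , _) with trans (sym L′≡) L≡
        ...   | ()
        settled fresh | inj₂ (L≡ , _) with trans (sym L′≡) L≡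
        ...   | refl = m≢ refl

    Partial-update : ∀ {T st′} q e p → Partial T st′ → Partial (T ∷ʳ (q , e , p)) (update (suc ℓ) q e p st′)
    Partial-update {st′ = st′} q e p part with L st′ (tgt e) p in L′≡
    ... | nothing = Extend.Partial-fresh part q e p L′≡
    ... | just m with m ≡ᵇ suc ℓ in m≡ᵇ
    ...   | true = Extend.Partial-revisit part q e p (trans L′≡ (cong just (≡ᵇ-true⇒≡ m (suc ℓ) m≡ᵇ)))
    ...   | false = Extend.Partial-stale part q e p L′≡ (≡ᵇ-false⇒≢ m (suc ℓ) m≡ᵇ)

    triplesFrom : V × Q → List Triple
    triplesFrom (v , q) = concatMap (λ e → concatMap (λ p → [ (q , e , p) ]) (post q e)) (Out v)

    Partial-processPair : ∀ T st′ vq → Partial T st′ → Partial (T ++ triplesFrom vq) (processPair (suc ℓ) st′ vq)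
    Partial-processPair T st′ (v , q) part =
      foldl-concatMap-invariant Partial _ _
        (λ T₁ st₁ e → foldl-concatMap-invariant Partial _ _ (λ _ _ p → Partial-update q e p) (post q e) T₁ st₁)
        (Out v) T st′ part

    module Complete (stop≡false : stop st ≡ false) {cur : List (V × Q)} (next≡cur : next st ≡ cur) where
      stF : State
      stF = foldl (processPair (suc ℓ)) (record st { next = [] }) cur

      TF : List Triple
      TF = concatMap triplesFrom cur

      open Partial (foldl-concatMap-invariant Partial triplesFrom (processPair (suc ℓ)) Partial-processPair
                                              cur [] _ (Partial-[] stop≡false))

      cur-∈ : ∀ {v q} → (v , q) ∈ cur ⇔ L st v q ≡ just ℓ
      cur-∈ {v} {q} = subst (λ c → (v , q) ∈ c ⇔ L st v q ≡ just ℓ) next≡cur (next-∈ v q)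

      TF-∈⁻ : ∀ {q e p} → (q , e , p) ∈ TF → (src e , q) ∈ cur × Step q e p
      TF-∈⁻ {q} {e} {p} qep∈ with find (∈-concatMap⁻ triplesFrom {xs = cur} qep∈)
      ... | (v , q′) , vq∈ , in-from with find (∈-concatMap⁻ _ {xs = Out v} in-from)
      ... | e′ , e′∈ , in-post with find (∈-concatMap⁻ _ {xs = post q′ e′} in-post)
      ... | p′ , p′∈ , here refl =
        subst (λ x → (x , q) ∈ cur) (sym (to (Out-spec v e) e′∈)) vq∈ , to (post-∈ q e p) p′∈

      TF-∈⁺ : ∀ {q e p} → (src e , q) ∈ cur → Step q e p → (q , e , p) ∈ TF
      TF-∈⁺ {q} {e} {p} eq∈ move =
        ∈-concatMap⁺ triplesFrom (lose eq∈ (∈-concatMap⁺ _ (lose (from (Out-spec (src e) e) refl)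
          (∈-concatMap⁺ _ (lose (from (post-∈ q e p) move) (here refl))))))

      current-Dist : ∀ {v q} → (v , q) ∈ cur → Dist ℓ v q
      current-Dist vq∈ = proj₂ (L-just _ _ ℓ (to cur-∈ vq∈))

      Hit⇒ReachableIn : ∀ {u p} → Hit TF u p → ReachableIn (suc ℓ) u p
      Hit⇒ReachableIn (q , e , refl , qep∈) =
        let eq∈ , move = TF-∈⁻ qep∈ in ReachableIn-suc⁺ (proj₁ (current-Dist eq∈)) move

      Hit⇒Dist : ∀ {u p} → L st u p ≡ nothing → Hit TF u p → Dist (suc ℓ) u p
      Hit⇒Dist {u} {p} fresh hit = Hit⇒ReachableIn hit , minimal
        where
        minimal : ∀ m → ReachableIn m u p → suc ℓ ≤ m
        minimal m r with m ≤? ℓ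
        ... | yes m≤ℓ = ⊥-elim (L-nothing u p fresh m m≤ℓ r)
        ... | no m≰ℓ = ≰⇒> m≰ℓ

      -- The predecessor on a path of length suc ℓ is at distance exactly ℓ,
      -- since a shorter one would have settled (u, p) already.
      ReachableIn⇒Hit : ∀ {u p} → L st u p ≡ nothing → ReachableIn (suc ℓ) u p → Hit TF u p
      ReachableIn⇒Hit {p = p} fresh r with ReachableIn-suc⁻ r
      ... | e , q , refl , r′ , move with L st (src e) q in L≡
      ...   | nothing = ⊥-elim (L-nothing _ _ L≡ ℓ ≤-refl r′)
      ...   | just m with L-just _ _ m L≡
      ...     | m≤ℓ , dist with m <? ℓ
      ...       | yes m<ℓ = ⊥-elim (L-nothing _ _ fresh (suc m) m<ℓ (ReachableIn-suc⁺ (proj₁ dist) move))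
      ...       | no m≮ℓ = q , e , refl ,
                    TF-∈⁺ (from cur-∈ (trans L≡ (cong just (≤-antisym m≤ℓ (≮⇒≥ m≮ℓ))))) move

      stF-L-just : ∀ v q m → L stF v q ≡ just m → m ≤ suc ℓ × Dist m v q
      stF-L-just v q m LF≡ with L st v q in L≡
      ... | just m′ with trans (sym (L-kept v q m′ L≡)) LF≡
      ...   | refl = map₁ m≤n⇒m≤1+n (L-just v q m′ L≡)
      stF-L-just v q m LF≡ | nothing with L-new v q L≡
      ...   | inj₁ (LF≡nothing , _) with trans (sym LF≡) LF≡nothing
      ...     | ()
      stF-L-just v q m LF≡ | nothing | inj₂ (LF≡suc , hit) with trans (sym LF≡suc) LF≡
      ...     | refl = ≤-refl , Hit⇒Dist L≡ hit

      stF-L-nothing : ∀ v q → L stF v q ≡ nothing → ∀ m → m ≤ suc ℓ → ¬ ReachableIn m v q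
      stF-L-nothing v q LF≡ m m≤ r with L st v q in L≡
      ... | just m′ with trans (sym (L-kept v q m′ L≡)) LF≡
      ...   | ()
      stF-L-nothing v q LF≡ m m≤ r | nothing with L-new v q L≡
      ...   | inj₂ (LF≡suc , _) with trans (sym LF≡suc) LF≡
      ...     | ()
      stF-L-nothing v q LF≡ m m≤ r | nothing | inj₁ (_ , not-hit) with m≤n⇒m<n∨m≡n m≤
      ...     | inj₁ m<suc = L-nothing v q L≡ m (≤-pred m<suc) r
      ...     | inj₂ refl = not-hit (ReachableIn⇒Hit L≡ r)

      stF-next-∈ : ∀ v q → (v , q) ∈ next stF ⇔ L stF v q ≡ just (suc ℓ)
      stF-next-∈ v q = mk⇔ listed⇒L L⇒listed
        where
        listed⇒L : (v , q) ∈ next stF → L stF v q ≡ just (suc ℓ)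
        listed⇒L listed with to (next-∈′ v q) listed
        ... | fresh , hit with L-new v q fresh
        ...   | inj₁ (_ , not-hit) = ⊥-elim (not-hit hit)
        ...   | inj₂ (LF≡ , _) = LF≡
        L⇒listed : L stF v q ≡ just (suc ℓ) → (v , q) ∈ next stF
        L⇒listed LF≡ with L st v q in L≡
        ... | just m with trans (sym (L-kept v q m L≡)) LF≡
        ...   | refl = ⊥-elim (<-irrefl refl (proj₁ (L-just v q m L≡)))
        L⇒listed LF≡ | nothing with L-new v q L≡
        ...   | inj₂ (_ , hit) = from (next-∈′ v q) (L≡ , hit)
        ...   | inj₁ (LF≡nothing , _) with trans (sym LF≡) LF≡nothing
        ...     | ()

      stF-B-∈ : ∀ u p i q → q ∈ B stF u p i ⇔ BEntry (suc ℓ) u p i q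
      stF-B-∈ u p i q = mk⇔ split join
        where
        split : q ∈ B stF u p i → BEntry (suc ℓ) u p i q
        split q∈ with to (B-∈′ u p i q) q∈
        ... | inj₁ old = map₂ (map₂ (map₂ (map₂ (map₁ m≤n⇒m≤1+n)))) (to (B-∈ u p i q) old)
        ... | inj₂ (fresh , e , tgt≡ , idx≡ , qep∈) =
          let eq∈ , move = TF-∈⁻ qep∈
              fresh′ = subst (λ x → L st x p ≡ nothing) (sym tgt≡) fresh
          in e , ℓ , tgt≡ , idx≡ , ≤-refl , move , current-Dist eq∈ , Hit⇒Dist fresh′ (q , e , refl , qep∈)
        join : BEntry (suc ℓ) u p i q → q ∈ B stF u p i
        join (e , m , tgt≡ , idx≡ , m<suc , move , dist-q , dist-p) with m≤n⇒m<n∨m≡n m<suc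
        ... | inj₁ m<ℓ = from (B-∈′ u p i q)
                           (inj₁ (from (B-∈ u p i q) (e , m , tgt≡ , idx≡ , ≤-pred m<ℓ , move , dist-q , dist-p)))
        ... | inj₂ refl with L st u p in L≡
        ...   | just m′ = ⊥-elim (<-irrefl refl
                  (subst (_≤ ℓ) (Dist-unique (proj₂ (L-just u p m′ L≡)) (subst (λ x → Dist (suc ℓ) x p) tgt≡ dist-p))
                         (proj₁ (L-just u p m′ L≡))))
        ...   | nothing = from (B-∈′ u p i q)
                  (inj₂ (L≡ , e , tgt≡ , idx≡ , TF-∈⁺ (from cur-∈ (Invariant-Dist⇒L inv dist-q ≤-refl)) move))

      stF-Invariant : Invariant (suc ℓ) stF
      stF-Invariant = record
        { L-just = stF-L-just ; L-nothing = stF-L-nothing ; next-∈ = stF-next-∈ ; B-∈ = stF-B-∈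
        ; stop-true = λ stop≡true → map₂ (map₂ Hit⇒ReachableIn) (stop-true′ stop≡true) }

  lookupQ-graph⁻ : ∀ (g : E → List Q) l {e q} → q ∈ lookupQ e (map (λ e′ → e′ , g e′) l) → q ∈ g e
  lookupQ-graph⁻ g (e′ ∷ l) {e} q∈ with e Fin.≟ e′
  ... | yes refl = q∈
  ... | no _ = lookupQ-graph⁻ g l q∈

  lookupQ-graph : ∀ (g : E → List Q) {l e} → e ∈ l → lookupQ e (map (λ e′ → e′ , g e′) l) ≡ g e
  lookupQ-graph g {e′ ∷ l} {e} e∈ with e Fin.≟ e′ | e∈
  ... | yes refl | _ = refl
  ... | no e≢e′ | here e≡e′ = ⊥-elim (e≢e′ e≡e′)
  ... | no _ | there e∈l = lookupQ-graph g e∈l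

  nonEmpty-∈ : ∀ {q : Q} {xs} → q ∈ xs → nonEmpty xs ≡ true
  nonEmpty-∈ (here _) = refl
  nonEmpty-∈ (there _) = refl

  lookupQ-trim : ∀ b e p q → q ∈ lookupQ e (trim b (tgt e) p) ⇔ q ∈ b (tgt e) p (tgtidx e)
  lookupQ-trim b e p q = mk⇔ (lookupQ-graph⁻ g (filter listed? (In (tgt e))))
    (λ q∈ → subst (q ∈_) (sym (lookupQ-graph g (∈-filter⁺ listed? (from (In-spec (tgt e) e) refl) (nonEmpty-∈ q∈))))
                  q∈)
    where
    g : E → List Q
    g e′ = b (tgt e) p (tgtidx e′)
    listed? = λ e′ → nonEmpty (g e′) Bool.≟ true

  annotated : State × ℕ
  annotated = loop (suc (nV * nQ)) 0 initState

  module Annotated (es★ : List E) (shortest★ : InSem (s , es★)) where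

    accepting-length : ∀ {m f} → f ∈ˢ F → ReachableIn m t f → length es★ ≤ m
    accepting-length {f = f} f∈F (es , refl , end≡ , i , i∈I , path) =
      proj₂ shortest★ (s , es) (Accepting⇒MatchST es (end≡ , i , f , i∈I , f∈F , path))

    -- The loop stops only once level length es★ is reached: an earlier layer is
    -- nonempty by shortest-Dist-at, and an earlier final pair would be too short.
    loop-Invariant : ∀ fuel ℓ st → Invariant ℓ st → length es★ ≤ ℓ + fuel →
                     Invariant (proj₂ (loop fuel ℓ st)) (proj₁ (loop fuel ℓ st)) ×
                     length es★ ≤ proj₂ (loop fuel ℓ st)
    loop-Invariant zero ℓ st inv enough = inv , subst (length es★ ≤_) (+-identityʳ ℓ) enough
    loop-Invariant (suc fuel) ℓ st inv enough with next st in next≡ | stop st in stop≡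
    ... | [] | _ = inv , reached
      where
      reached : length es★ ≤ ℓ
      reached with length es★ ≤? ℓ
      ... | yes Λ≤ℓ = Λ≤ℓ
      ... | no Λ≰ℓ with shortest-Dist-at es★ shortest★ ℓ (<⇒≤ (≰⇒> Λ≰ℓ))
      ...   | v , q , dist
        with subst ((v , q) ∈_) next≡ (from (Invariant.next-∈ inv v q) (Invariant-Dist⇒L inv dist ≤-refl))
      ...     | ()
    ... | _ ∷ _ | false =
      loop-Invariant fuel (suc ℓ) _ (Layer.Complete.stF-Invariant inv stop≡ next≡)
                     (subst (length es★ ≤_) (+-suc ℓ fuel) enough)
    ... | _ ∷ _ | true with Invariant.stop-true inv stop≡
    ...   | f , f∈F , r = inv , accepting-length f∈F r

    annotated-Invariant : Invariant (proj₂ annotated) (proj₁ annotated) × length es★ ≤ proj₂ annotated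
    annotated-Invariant =
      loop-Invariant (suc (nV * nQ)) 0 initState initState-Invariant
                     (m≤n⇒m≤1+n (<⇒≤ (shortest-length< es★ shortest★)))

    X-∈ : ∀ e p q → q ∈ X e p ⇔ (∃[ m ] (suc m ≤ proj₂ annotated × ShortestStep m q e p))
    X-∈ e p q = mk⇔ X⇒ ⇒X
      where
      B-∈ = Invariant.B-∈ (proj₁ annotated-Invariant) (tgt e) p (tgtidx e) q
      X⇒ : q ∈ X e p → ∃[ m ] (suc m ≤ proj₂ annotated × ShortestStep m q e p)
      X⇒ q∈ with to B-∈ (to (lookupQ-trim (B (proj₁ annotated)) e p q) q∈)
      ... | e′ , m , tgt≡ , idx≡ , rest
        with indexOf-injective (In (tgt e)) (from (In-spec (tgt e) e′) tgt≡) (from (In-spec (tgt e) e) refl)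
               (subst (λ u → indexOf e′ (In u) ≡ tgtidx e) tgt≡ idx≡)
      ... | refl = m , rest
      ⇒X : ∃[ m ] (suc m ≤ proj₂ annotated × ShortestStep m q e p) → q ∈ X e p
      ⇒X (m , rest) = from (lookupQ-trim (B (proj₁ annotated)) e p q) (from B-∈ (e , m , refl , refl , rest))

  -- The content of p ∈ S(w), with the prefix walk wₚ normalised to start at s.
  Split : Walk → Q → List E → Set
  Split w p esp = InSem (s , esp ++ edges w) × end′ s esp ≡ start w ×
                  ∃₂ λ i f → i ∈ˢ I × f ∈ˢ F × Path i s esp p × Path p (start w) (edges w) f

  S⇒Split : ∀ {w p} → S w p → ∃[ esp ] Split w p esp
  S⇒Split {w} ((_ , esp) , end≡ , shortest , (i , _ , i∈I , labels , run) , (f , _ , f∈F , labels′ , run′))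
    with MatchST⇒Accepting (proj₁ shortest)
  ... | refl , _ with IsWalk′-++⁻ s esp (edges w) (proj₁ (proj₁ shortest))
  ...   | walk , walk′ =
    esp , shortest , end≡ , i , f , i∈I , f∈F , walk-run⇒Path walk labels run ,
    walk-run⇒Path (subst (λ v → IsWalk′ v (edges w)) end≡ walk′) labels′ run′

  Split⇒S : ∀ {w p esp} → Split w p esp → S w p
  Split⇒S {esp = esp} (shortest , end≡ , i , f , i∈I , f∈F , path , path′)
    with Path⇒walk-run path | Path⇒walk-run path′
  ... | _ , u , labels , run | _ , u′ , labels′ , run′ =
    (s , esp) , end≡ , shortest , (i , u , i∈I , labels , run) , (f , u′ , f∈F , labels′ , run′)

  Split⇒Dist : ∀ {w p esp} → Split w p esp → Dist (length esp) (start w) p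
  Split⇒Dist {w} {esp = esp} (shortest , end≡ , _ , _ , i∈I , f∈F , path , path′) =
    shortest-prefix-Dist esp (edges w) shortest end≡ i∈I path f∈F path′

  Split-end : ∀ {w p esp} → Split w p esp → end′ (start w) (edges w) ≡ t
  Split-end {w} {esp = esp} (shortest , end≡ , _) = begin
    end′ (start w) (edges w)       ≡⟨ cong (λ v → end′ v (edges w)) end≡ ⟨
    end′ (end′ s esp) (edges w)    ≡⟨ end′-++ s esp (edges w) ⟨
    end′ s (esp ++ edges w)        ≡⟨ proj₁ (proj₂ (MatchST⇒Accepting (proj₁ shortest))) ⟩
    t                              ∎
    where open ≡-Reasoning

  S-◂⇒ : ∀ {e w q} → tgt e ≡ start w → S (e ◂ w) q → ∃[ p ] (S w p × q ∈ X e p)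
  S-◂⇒ {e} {w} {q} tgt≡ Sq with S⇒Split Sq
  ... | esq , split-q@(shortest , end≡ , i , f , i∈I , f∈F , path , cons {p = p} _ move path′) =
    p , Split⇒S split-p ,
    from (Annotated.X-∈ _ shortest e p q) (length esq , in-time , move , Split⇒Dist split-q , Dist-p)
    where
    split-p : Split w p (esq ∷ʳ e)
    split-p = subst (λ l → InSem (s , l)) (sym (++-assoc esq [ e ] (edges w))) shortest ,
              trans (end′-++ s esq [ e ]) tgt≡ , i , f , i∈I , f∈F ,
              Path-++⁺ path (cons (sym end≡) move nil) , subst (λ v → Path p v (edges w) f) tgt≡ path′
    Dist-p : Dist (suc (length esq)) (tgt e) p
    Dist-p = subst₂ (λ m v → Dist m v p) (length-∷ʳ esq e) (sym tgt≡) (Split⇒Dist split-p)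
    in-time : suc (length esq) ≤ proj₂ annotated
    in-time = ≤-trans (≤-trans (s≤s (length-++-≤ˡ esq)) (≤-reflexive (sym (length-++-sucʳ esq e (edges w)))))
                      (proj₂ (Annotated.annotated-Invariant _ shortest))

  S-◂⇐ : ∀ {e w p q} → tgt e ≡ start w → S w p → q ∈ X e p → S (e ◂ w) q
  S-◂⇐ {e} {w} {p} {q} tgt≡ Sp q∈X with S⇒Split Sp
  ... | esp , split-p@(shortest , _ , _ , f , _ , f∈F , _ , path′)
    with to (Annotated.X-∈ _ shortest e p q) q∈X
  ...   | m , _ , move , ((esq , len≡ , end≡ , i , i∈I , path) , _) , Dist-p =
    Split⇒S (shortest′ , end≡ , i , f , i∈I , f∈F , path , cons refl move path″)
    where
    path″ : Path p (tgt e) (edges w) f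
    path″ = subst (λ v → Path p v (edges w) f) (sym tgt≡) path′
    same-length : length esp ≡ suc m
    same-length = Dist-unique (Split⇒Dist split-p) (subst (λ v → Dist (suc m) v p) tgt≡ Dist-p)
    open ≡-Reasoning
    lengths : length (esq ++ e ∷ edges w) ≡ length (esp ++ edges w)
    lengths = begin
      length (esq ++ e ∷ edges w)          ≡⟨ length-++-sucʳ esq e (edges w) ⟩
      suc (length (esq ++ edges w))        ≡⟨ cong suc (length-++ esq) ⟩
      suc (length esq + length (edges w))  ≡⟨ cong (λ n → suc n + length (edges w)) len≡ ⟩
      suc m + length (edges w)             ≡⟨ cong (_+ length (edges w)) same-length ⟨
      length esp + length (edges w)        ≡⟨ length-++ esp ⟨
      length (esp ++ edges w)              ∎
    end≡t : end′ s (esq ++ e ∷ edges w) ≡ t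
    end≡t = begin
      end′ s (esq ++ e ∷ edges w)  ≡⟨ end′-++ s esq (e ∷ edges w) ⟩
      end′ (tgt e) (edges w)       ≡⟨ cong (λ v → end′ v (edges w)) tgt≡ ⟩
      end′ (start w) (edges w)     ≡⟨ Split-end split-p ⟩
      t                            ∎
    shortest′ : InSem (s , esq ++ e ∷ edges w)
    shortest′ = Accepting⇒MatchST _ (end≡t , i , f , i∈I , f∈F , Path-++⁺ path (cons (sym end≡) move path″)) ,
                λ w′ match → ≤-trans (≤-reflexive lengths) (proj₂ shortest w′ match)

lemma3p5 : ∀ {k} (D : Database k) (A : Automaton k) (s t : Fin (Database.nV D)) →
    let open Database D
        open Automaton A
        open Semantics D A s t
    in (∃[ w₀ ] MatchST w₀) →
       (e : Fin nE) (w : Walk) → tgt e ≡ start w → Node (e ◂ w) →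
       (q : Fin nQ) → S (e ◂ w) q ⇔ (∃[ p ] (S w p × q ∈ X e p))
lemma3p5 D A s t _ e w tgt≡ _ q =
  mk⇔ (S-◂⇒ D A s t tgt≡) (λ (p , Sp , q∈X) → S-◂⇐ D A s t tgt≡ Sp q∈X)
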